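{- Let $\mathcal{M}=\langle S,\to,L\rangle$ be a labeled transition system, let $B\subseteq S\times S$ be a skipping simulation on $\mathcal{M}$, and let $s,u,w\in S$ with $sBw$, $s\to u$, and $\langle s,u\rangle$ a node of $\mathit{ranktCt}(\mathcal{M},s,w)$. Then $\mathit{size}(\mathit{ranktCt}(\mathcal{M},u,w))\prec\mathit{size}(\mathit{ranktCt}(\mathcal{M},s,w))$.
   Context: A labeled transition system $\mathcal{M}=\langle S,\to,L\rangle$ consists of a non-empty set $S$, a left-total relation $\to\ \subseteq S\times S$, and a labeling function $L$ with domain $S$. A fullpath is an infinite sequence $\sigma(0),\sigma(1),\dots$ with $\sigma(i)\to\sigma(i+1)$ for all $i$, starting at $\sigma(0)$. $w\to^{+}v$ means $v$ is reachable from $w$ in finitely many, at least one, steps. Let INC be the set of strictly increasing $\pi:\omega\to\omega$ with $\pi(0)=0$. For fullpaths $\sigma,\delta$, $\mathit{match}(B,\sigma,\delta)$ holds iff there are $\pi,\xi\in$ INC such that for every $i\in\omega$ and every $j$ with $\pi(i)\le j<\pi(i+1)$, $\sigma(j)\,B\,\delta(\xi(i))$. $B$ is a skipping simulation (SKS) on $\mathcal{M}$ iff for all $s,w$ with $sBw$: $L(s)=L(w)$, and for every fullpath $\sigma$ starting at $s$ there is a fullpath $\delta$ starting at $w$ with $\mathit{match}(B,\sigma,\delta)$. The computation tree $\mathit{ctree}(\mathcal{M},s)$ is the smallest tree of finite sequences over $S$ with root $\langle s\rangle$ such that if $\langle s,\dots,x\rangle$ is a node and $x\to y$ then $\langle s,\dots,x,y\rangle$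 is a node with parent $\langle s,\dots,x\rangle$. If not $sBw$, $\mathit{ranktCt}(\mathcal{M},s,w)$ is the empty tree; otherwise it is the largest subtree of $\mathit{ctree}(\mathcal{M},s)$ (containing the root, closed under parents) such that every non-root node $\langle s,\dots,x\rangle$ satisfies $xBw$ and there is no $v$ with $w\to^{+}v$ and $xBv$. (Every path of this tree is finite.) For a tree $t$ all of whose paths are finite, $\mathit{size}(t,x)=\bigcup_{c\text{ a child of }x}(\mathit{size}(t,c)+1)$ (an ordinal), and $\mathit{size}(t)$ is the size of the root of $t$. $\prec$ is the strict order on ordinals. -}

module Defs where

open import Level using (0ℓ)
open import Data.Nat using (ℕ; zero; suc; _≤_; _<_)
open import Data.Product using (Σ; Σ-syntax; ∃; ∃-syntax; _×_; _,_)
open import Data.List using (List; []; _∷_; [_]; _∷ʳ_)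
open import Relation.Nullary using (¬_)
open import Relation.Binary using (Rel)
open import Relation.Binary.PropositionalEquality using (_≡_)
open import Relation.Binary.Construct.Closure.Transitive using (TransClosure)
open import Induction.WellFounded using (Acc; acc)

-- Ordinals (constructive, Brouwer/Aczel-style "rank" encoding).
-- `node I f` denotes the ordinal  ⋃_{i ∈ I} (f i + 1),
-- exactly the shape of the paper's size(t,x) = ⋃_c (size(t,c)+1).

data Ord : Set₁ where
  node : (I : Set) → (I → Ord) → Ord

_⪯_ : Ord → Ord → Set
_≺_ : Ord → Ord → Set
node I f ⪯ β = (i : I) → f i ≺ β
α ≺ node J g = Σ J λ j → α ⪯ g j

record LTS : Set₁ where
  field
    S     : Set
    _⟶_   : S → S → Set
    total : (s : S) → ∃ λ t → s ⟶ t
    Lab   : Set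
    L     : S → Lab

module _ (M : LTS) where
  open LTS M

  IsFullpath : (ℕ → S) → Set
  IsFullpath σ = (i : ℕ) → σ i ⟶ σ (suc i)

  IsINC : (ℕ → ℕ) → Set
  IsINC π = (π 0 ≡ 0) × ((i : ℕ) → π i < π (suc i))

  match : Rel S 0ℓ → (ℕ → S) → (ℕ → S) → Set
  match B σ δ = Σ[ π ∈ (ℕ → ℕ) ] Σ[ ξ ∈ (ℕ → ℕ) ]
    IsINC π × IsINC ξ ×
    ((i j : ℕ) → π i ≤ j → j < π (suc i) → B (σ j) (δ (ξ i)))

  SKS : Rel S 0ℓ → Set
  SKS B = (s w : S) → B s w →
    (L s ≡ L w) ×
    ((σ : ℕ → S) → IsFullpath σ → σ 0 ≡ s →
      Σ[ δ ∈ (ℕ → S) ] IsFullpath δ × (δ 0 ≡ w) × match B σ δ)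

  _⟶⁺_ : S → S → Set
  _⟶⁺_ = TransClosure _⟶_

  module _ (B : Rel S 0ℓ) where

    Good : S → S → Set
    Good w x = B x w × ¬ (Σ[ v ∈ S ] (w ⟶⁺ v) × B x v)

    -- Membership in ranktCt(M,s,w) (nodes are finite sequences, as lists).
    -- Empty if ¬ sBw; otherwise the nodes of ctree(M,s) all of whose
    -- non-root prefixes end in a Good state (= the largest such subtree).
    data ranktCt (s w : S) : List S → Set where
      root  : B s w → ranktCt s w [ s ]
      child : ∀ {ns x y} → ranktCt s w (ns ∷ʳ x) → x ⟶ y → Good w y →
              ranktCt s w ((ns ∷ʳ x) ∷ʳ y)

module _ {S : Set} where

  ChildIn : (List S → Set) → List S → List S → Set
  ChildIn T m n = T m × (Σ[ y ∈ S ] m ≡ n ∷ʳ y)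

  -- "all paths of T below n are finite", constructively: n is accessible
  -- for the child relation.
  -- size(t,n) = ⋃_{c child of n} (size(t,c) + 1)
  size : (T : List S → Set) (n : List S) → Acc (ChildIn T) n → Ord
  size T n (acc rs) =
    node (Σ[ m ∈ List S ] ChildIn T m n) (λ { (m , c) → size T m (rs c) })

-- The tree ranktCt(M,u,w), prefixed with s, embeds into the subtree of
-- ranktCt(M,s,w) rooted at ⟨s,u⟩: both impose the same condition Good w on
-- non-root nodes. Size is monotone under such embeddings, and a child is
-- strictly smaller than its parent.
module Submission where

open import Defs
open import Level using (0ℓ)
open import Data.List using (List; _∷_; [_]; _∷ʳ_)
open import Data.Product using (_,_)
open import Relation.Binary using (Rel)
open import Relation.Binary.PropositionalEquality using (refl)
open import Induction.WellFounded using (Acc; acc)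

module _ {S : Set} where

  size-mono : (T T′ : List S → Set) (f : List S → List S) →
              (∀ {m n} → ChildIn T m n → ChildIn T′ (f m) (f n)) →
              ∀ n (aT : Acc (ChildIn T) n) (aT′ : Acc (ChildIn T′) (f n)) →
              size T n aT ⪯ size T′ (f n) aT′
  size-mono T T′ f embed n (acc rs) (acc rs′) (m , c) =
    (f m , embed c) , size-mono T T′ f embed m (rs c) (rs′ (embed c))

  ≺-size-parent : ∀ (T : List S → Set) {m n} {α : Ord} (c : ChildIn T m n)
                  (an : Acc (ChildIn T) n) →
                  (∀ am → α ⪯ size T m am) → α ≺ size T n an
  ≺-size-parent T c (acc rs) α⪯ = (_ , c) , α⪯ (rs c)

module _ (M : LTS) (B : Rel (LTS.S M) 0ℓ) {s u w : LTS.S M}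
         (su : ranktCt M B s w ([ s ] ∷ʳ u)) where

  ranktCt-prefix : ∀ {ns} → ranktCt M B u w ns → ranktCt M B s w (s ∷ ns)
  ranktCt-prefix (root _)              = su
  ranktCt-prefix (child {ns} r step g) = child {ns = s ∷ ns} (ranktCt-prefix r) step g

  ChildIn-prefix : ∀ {m n} → ChildIn (ranktCt M B u w) m n →
                   ChildIn (ranktCt M B s w) (s ∷ m) (s ∷ n)
  ChildIn-prefix (tm , y , refl) = ranktCt-prefix tm , y , refl

-- Only the membership of ⟨s,u⟩ in ranktCt(M,s,w) is needed.
lemma3 : (M : LTS) (B : Rel (LTS.S M) 0ℓ) → SKS M B →
    (s u w : LTS.S M) → B s w → LTS._⟶_ M s u →
    ranktCt M B s w ([ s ] ∷ʳ u) →
    (accS : Acc (ChildIn (ranktCt M B s w)) [ s ]) →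
    (accU : Acc (ChildIn (ranktCt M B u w)) [ u ]) →
    size (ranktCt M B u w) [ u ] accU ≺ size (ranktCt M B s w) [ s ] accS
lemma3 M B _ s u w _ _ su accS accU =
  ≺-size-parent (ranktCt M B s w) (su , u , refl) accS
    (size-mono (ranktCt M B u w) (ranktCt M B s w) (s ∷_)
               (ChildIn-prefix M B su) [ u ] accU)
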